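{- Let $G$ be a bipartite graph with bipartition classes $A,B$ such that $A$ is countably infinite and $A$ is $\aleph_0$-star-linked, and let $a\in A$. Then for any vertex $x\in A\setminus\{a\}$ there is an $\{x\}$-robust ray $R$ in $G$ (a generalised path of order type $\omega$) with first vertex $a$ whose vertex set contains $A$. Moreover, $R-x$ admits a path order (making it a generalised path of order type $\omega$) whose first vertex is $a$.
   Context: A generalised path is a graph $P$ with a well-order $\prec$ on $V(P)$ (path order) such that for every vertex $v$ and every $v'\prec v$ there is a neighbour $w$ of $v$ in $P$ with $v'\preceq w\prec v$. $A$ is $\aleph_0$-star-linked if every finite $F\subseteq A$ has infinitely many common neighbours in $G$. A path $P$ is $X$-robust if for every $X'\subseteq X$ the graph $P-X'$ admits a well-order making it a generalised path of the same order type as $P$. -}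

module Defs where

open import Level using (Level; _⊔_) renaming (suc to lsuc; zero to lzero)
open import Data.Nat using (ℕ; zero; suc; _≤_; _<_)
open import Data.Product using (Σ; ∃; _×_; _,_)
open import Data.Sum using (_⊎_)
open import Data.List using (List)
open import Data.List.Relation.Unary.All using (All)
open import Data.List.Membership.Propositional using (_∈_)
open import Relation.Nullary using (¬_; Dec)
open import Relation.Binary.PropositionalEquality using (_≡_)

record Graph : Set₁ where
  field
    V     : Set
    E     : V → V → Set
    E-sym : ∀ {u v} → E u v → E v u
    E-irr : ∀ {v} → ¬ E v v

module _ (G : Graph) where
  open Graph G

  IsBipartition : (A B : V → Set) → Set
  IsBipartition A B =
    (∀ v → A v ⊎ B v) × (∀ v → ¬ (A v × B v)) ×
    (∀ u v → E u v → (A u × B v) ⊎ (B u × A v))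

  CountablyInfinite : (A : V → Set) → Set
  CountablyInfinite A = Σ (ℕ → V) λ g →
    (∀ m n → g m ≡ g n → m ≡ n) × (∀ n → A (g n)) × (∀ v → A v → ∃ λ n → g n ≡ v)

  -- Every finite F ⊆ A has infinitely many common neighbours in G
  -- ("infinitely many": outside every finite list of vertices).
  StarLinkedℵ₀ : (A : V → Set) → Set
  StarLinkedℵ₀ A = (F : List V) → All A F →
    (L : List V) → ∃ λ w → All (E w) F × ¬ (w ∈ L)

  record Subgraph : Set₁ where
    field
      S      : V → Set
      ES     : V → V → Set
      ES-sub : ∀ {u v} → ES u v → E u v × S u × S v
      ES-sym : ∀ {u v} → ES u v → ES v u

  delete : Subgraph → (V → Set) → Subgraph
  delete P X' = record
    { S = λ v → Subgraph.S P v × ¬ X' v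
    ; ES = λ u v → Subgraph.ES P u v × ¬ X' u × ¬ X' v
    ; ES-sub = λ { (e , nu , nv) → let (e' , su , sv) = Subgraph.ES-sub P e in e' , (su , nu) , (sv , nv) }
    ; ES-sym = λ { (e , nu , nv) → Subgraph.ES-sym P e , nv , nu }
    }

  -- f : ℕ → V enumerates V(P) bijectively, and the induced order
  -- (f m ≺ f n iff m < n, a well-order of type ω) is a path order:
  -- for every vertex f n and every f m ≺ f n there is a neighbour f k
  -- of f n in P with f m ⪯ f k ≺ f n.
  IsPathOrderω : Subgraph → (ℕ → V) → Set
  IsPathOrderω P f =
    (∀ m n → f m ≡ f n → m ≡ n) ×
    (∀ n → Subgraph.S P (f n)) ×
    (∀ v → Subgraph.S P v → ∃ λ n → f n ≡ v) ×
    (∀ m n → m < n → ∃ λ k → m ≤ k × k < n × Subgraph.ES P (f n) (f k))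

  IsRay : Subgraph → Set
  IsRay P = ∃ λ f → IsPathOrderω P f

  IsRobustω : Subgraph → (V → Set) → Set₁
  IsRobustω P X = (X' : V → Set) → (∀ v → Dec (X' v)) → (∀ v → X' v → X v) →
    IsRay (delete P X')

module Submission where

open import Defs
open import Data.Empty using (⊥-elim)
open import Data.Nat using (ℕ; zero; suc; _≤_; _<_; s≤s)
open import Data.Nat.Properties using (_≟_; <-cmp; m≤n⇒m<n∨m≡n; ≤-refl)
open import Data.Product using (Σ; ∃; _×_; _,_; proj₁; proj₂)
open import Data.Sum using (_⊎_; inj₁; inj₂)
open import Data.List using (List; []; _∷_)
open import Data.List.Relation.Unary.All as All using (All; []; _∷_)
open import Data.List.Relation.Unary.Any using (here; there)
open import Data.List.Membership.Propositional using (_∈_; _∉_)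
open import Function using (_∘_)
open import Relation.Nullary using (¬_; yes; no)
open import Relation.Binary using (tri<; tri≈; tri>)
open import Relation.Binary.PropositionalEquality
  using (_≡_; _≢_; refl; sym; trans; cong; subst; subst₂)

-- Enumerate A as e₀ = a, e₁ = x, e₂, … and choose distinct vertices b₀, b₁, …
-- with bₙ a common neighbour of eₙ, eₙ₊₁, eₙ₊₂ (a fresh one exists as A is
-- ℵ₀-star-linked; it lies in B).  The edges bₙeₙ, bₙeₙ₊₁, bₙeₙ₊₂ form R, ordered
-- e₀ b₀ e₁ b₁ e₂ …, and the edges bₙeₙ₊₂ make R − e₁ a ray e₀ b₀ e₂ b₁ e₃ b₂ … too.

transpose : ℕ → ℕ → ℕ → ℕ
transpose i j n with n ≟ i | n ≟ j
... | yes _ | _     = j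
... | no _  | yes _ = i
... | no _  | no _  = n

transpose-fixes : ∀ i j n → n ≢ i → n ≢ j → transpose i j n ≡ n
transpose-fixes i j n n≢i n≢j with n ≟ i | n ≟ j
... | yes n≡i | _       = ⊥-elim (n≢i n≡i)
... | no _    | yes n≡j = ⊥-elim (n≢j n≡j)
... | no _    | no _    = refl

transpose-left : ∀ i j → transpose i j i ≡ j
transpose-left i j with i ≟ i | i ≟ j
... | yes _   | _ = refl
... | no i≢i  | _ = ⊥-elim (i≢i refl)

transpose-right : ∀ i j → transpose i j j ≡ i
transpose-right i j with j ≟ i | j ≟ j
... | yes j≡i | _       = j≡i
... | no _    | yes _   = refl
... | no _    | no j≢j  = ⊥-elim (j≢j refl)

transpose-involutive : ∀ i j n → transpose i j (transpose i j n) ≡ n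
transpose-involutive i j n with n ≟ i | n ≟ j
... | yes refl | _        = transpose-right n j
... | no _     | yes refl = transpose-left i n
... | no n≢i   | no n≢j   = transpose-fixes i j n n≢i n≢j

Enumerates : {V : Set} → (V → Set) → (ℕ → V) → Set
Enumerates A g =
  (∀ m n → g m ≡ g n → m ≡ n) × (∀ n → A (g n)) × (∀ v → A v → ∃ λ n → g n ≡ v)

module _ {V : Set} {A : V → Set} where

  enumerates-∘-involution : ∀ {g} (π : ℕ → ℕ) → (∀ n → π (π n) ≡ n) →
    Enumerates A g → Enumerates A (g ∘ π)
  enumerates-∘-involution {g} π π-inv (inj , inA , surj) =
    (λ m n eq → trans (sym (π-inv m)) (trans (cong π (inj _ _ eq)) (π-inv n))) ,
    (λ n → inA (π n)) ,
    λ v Av → π (proj₁ (surj v Av)) ,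
             trans (cong g (π-inv _)) (proj₂ (surj v Av))

  enumeration-starting-with : ∀ {g a x} → Enumerates A g → A a → A x → x ≢ a →
    ∃ λ e → Enumerates A e × e 0 ≡ a × e 1 ≡ x
  enumeration-starting-with {g} {x = x} enum Aa Ax x≢a with proj₂ (proj₂ enum) _ Aa
  ... | i , refl = second-index (proj₂ (proj₂ enum₀) _ Ax)
    where
    enum₀ : Enumerates A (g ∘ transpose 0 i)
    enum₀ = enumerates-∘-involution (transpose 0 i) (transpose-involutive 0 i) enum

    second-index : (∃ λ j → g (transpose 0 i j) ≡ x) →
      ∃ λ e → Enumerates A e × e 0 ≡ g i × e 1 ≡ x
    second-index (j , refl) =
      g ∘ transpose 0 i ∘ transpose 1 j ,
      enumerates-∘-involution (transpose 1 j) (transpose-involutive 1 j) enum₀ ,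
      cong (g ∘ transpose 0 i) (transpose-fixes 1 j 0 (λ ()) (j≢0 ∘ sym)) ,
      cong (g ∘ transpose 0 i) (transpose-left 1 j)
      where
      j≢0 : j ≢ 0
      j≢0 j≡0 = x≢a (trans (cong (g ∘ transpose 0 i) j≡0) (cong g (transpose-left 0 i)))

double : ℕ → ℕ
double zero    = zero
double (suc n) = suc (suc (double n))

data Parity : ℕ → Set where
  even : ∀ k → Parity (double k)
  odd  : ∀ k → Parity (suc (double k))

parity : ∀ n → Parity n
parity zero = even 0
parity (suc n) with parity n
... | even k = odd k
... | odd k  = even (suc k)

module _ {X : Set} where

  interleave : (ℕ → X) → (ℕ → X) → ℕ → X
  interleave u w zero    = u 0
  interleave u w (suc n) = interleave w (u ∘ suc) n

  interleave-even : ∀ u w k → interleave u w (double k) ≡ u k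
  interleave-even u w zero    = refl
  interleave-even u w (suc k) = interleave-even (u ∘ suc) (w ∘ suc) k

  interleave-odd : ∀ u w k → interleave u w (suc (double k)) ≡ w k
  interleave-odd u w = interleave-even w (u ∘ suc)

  interleave-injective : ∀ {u w} →
    (∀ m n → u m ≡ u n → m ≡ n) → (∀ m n → w m ≡ w n → m ≡ n) → (∀ m n → u m ≢ w n) →
    ∀ m n → interleave u w m ≡ interleave u w n → m ≡ n
  interleave-injective {u} {w} u-inj w-inj u≢w m n eq with parity m | parity n
  ... | even k | even l = cong double (u-inj k l
    (trans (sym (interleave-even u w k)) (trans eq (interleave-even u w l))))
  ... | even k | odd l  = ⊥-elim (u≢w k l
    (trans (sym (interleave-even u w k)) (trans eq (interleave-odd u w l))))
  ... | odd k  | even l = ⊥-elim (u≢w l k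
    (trans (sym (interleave-even u w l)) (trans (sym eq) (interleave-odd u w k))))
  ... | odd k  | odd l  = cong (suc ∘ double) (w-inj k l
    (trans (sym (interleave-odd u w k)) (trans eq (interleave-odd u w l))))

  interleave-surjective : ∀ u w v → (∃ λ k → u k ≡ v) ⊎ (∃ λ k → w k ≡ v) →
    ∃ λ n → interleave u w n ≡ v
  interleave-surjective u w v (inj₁ (k , refl)) = double k , interleave-even u w k
  interleave-surjective u w v (inj₂ (k , refl)) = suc (double k) , interleave-odd u w k

  interleave-steps : (_~_ : X → X → Set) {u w : ℕ → X} →
    (∀ n → w n ~ u n) → (∀ n → u (suc n) ~ w n) →
    ∀ n → interleave u w (suc n) ~ interleave u w n
  interleave-steps _~_ {u} {w} w~u u~w n with parity n
  ... | even k = subst₂ _~_ (sym (interleave-odd u w k)) (sym (interleave-even u w k)) (w~u k)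
  ... | odd k  =
    subst₂ _~_ (sym (interleave-even u w (suc k))) (sym (interleave-odd u w k)) (u~w k)

module FreshSequence {V : Set} (P : ℕ → V → Set)
  (fresh : ∀ n (L : List V) → ∃ λ v → P n v × v ∉ L) where

  chosen : ℕ → List V
  chosen zero    = []
  chosen (suc n) = proj₁ (fresh n (chosen n)) ∷ chosen n

  pick : ℕ → V
  pick n = proj₁ (fresh n (chosen n))

  pick-satisfies : ∀ n → P n (pick n)
  pick-satisfies n = proj₁ (proj₂ (fresh n (chosen n)))

  pick∉chosen : ∀ n → pick n ∉ chosen n
  pick∉chosen n = proj₂ (proj₂ (fresh n (chosen n)))

  pick∈chosen : ∀ {m n} → m < n → pick m ∈ chosen n
  pick∈chosen {m} {suc n} (s≤s m≤n) with m≤n⇒m<n∨m≡n m≤n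
  ... | inj₁ m<n  = there (pick∈chosen m<n)
  ... | inj₂ refl = here refl

  pick-injective : ∀ m n → pick m ≡ pick n → m ≡ n
  pick-injective m n eq with <-cmp m n
  ... | tri< m<n _ _ = ⊥-elim (pick∉chosen n (subst (_∈ chosen n) eq (pick∈chosen m<n)))
  ... | tri≈ _ m≡n _ = m≡n
  ... | tri> _ _ n<m = ⊥-elim (pick∉chosen m (subst (_∈ chosen m) (sym eq) (pick∈chosen n<m)))

module _ (G : Graph) where
  open Graph G

  A-independent : ∀ {A B} → IsBipartition G A B → ∀ {u v} → E u v → A u → ¬ A v
  A-independent (_ , disjoint , crossing) {u} {v} uv Au Av with crossing u v uv
  ... | inj₁ (_ , Bv) = disjoint v (Av , Bv)
  ... | inj₂ (Bu , _) = disjoint u (Au , Bu)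

  walk⇒IsPathOrderω : (P : Subgraph G) {f : ℕ → V} →
    (∀ m n → f m ≡ f n → m ≡ n) → (∀ v → Subgraph.S P v → ∃ λ n → f n ≡ v) →
    (∀ n → Subgraph.ES P (f (suc n)) (f n)) → IsPathOrderω G P f
  walk⇒IsPathOrderω P {f} inj cover step =
    inj , (λ n → proj₂ (proj₂ (Subgraph.ES-sub P (step n)))) , cover , back
    where
    back : ∀ m n → m < n → ∃ λ k → m ≤ k × k < n × Subgraph.ES P (f n) (f k)
    back m (suc n) (s≤s m≤n) = n , m≤n , ≤-refl , step n

  alternating⇒IsPathOrderω : (P : Subgraph G) {u w : ℕ → V} →
    (∀ m n → u m ≡ u n → m ≡ n) → (∀ m n → w m ≡ w n → m ≡ n) → (∀ m n → u m ≢ w n) →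
    (∀ n → Subgraph.ES P (w n) (u n)) → (∀ n → Subgraph.ES P (u (suc n)) (w n)) →
    (∀ v → Subgraph.S P v → (∃ λ k → u k ≡ v) ⊎ (∃ λ k → w k ≡ v)) →
    IsPathOrderω G P (interleave u w)
  alternating⇒IsPathOrderω P {u} {w} u-inj w-inj u≢w w~u u~w cover =
    walk⇒IsPathOrderω P (interleave-injective u-inj w-inj u≢w)
      (λ v Sv → interleave-surjective u w v (cover v Sv))
      (interleave-steps (Subgraph.ES P) w~u u~w)

  IsPathOrderω-delete-∅ : ∀ (P : Subgraph G) {f} (X : V → Set) → (∀ v → ¬ X v) →
    IsPathOrderω G P f → IsPathOrderω G (delete G P X) f
  IsPathOrderω-delete-∅ P X ∅ (inj , inP , surj , back) =
    inj , (λ n → inP n , ∅ _) , (λ v → surj v ∘ proj₁) ,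
    λ m n m<n → let (k , m≤k , k<n , kn) = back m n m<n in k , m≤k , k<n , kn , ∅ _ , ∅ _

module RobustRay (G : Graph) {A B : Graph.V G → Set} (bip : IsBipartition G A B)
  (starLinked : StarLinkedℵ₀ G A) {e : ℕ → Graph.V G} (enum : Enumerates A e) where
  open Graph G

  e-injective : ∀ m n → e m ≡ e n → m ≡ n
  e-injective = proj₁ enum

  e∈A : ∀ n → A (e n)
  e∈A = proj₁ (proj₂ enum)

  triple : ℕ → List V
  triple n = e n ∷ e (suc n) ∷ e (suc (suc n)) ∷ []

  AdjacentToTriple : ℕ → V → Set
  AdjacentToTriple n w = All (E w) (triple n)

  fresh-common-neighbour : ∀ n (L : List V) → ∃ λ w → AdjacentToTriple n w × w ∉ L
  fresh-common-neighbour n = starLinked (triple n) (e∈A n ∷ e∈A (suc n) ∷ e∈A (suc (suc n)) ∷ [])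

  open FreshSequence AdjacentToTriple fresh-common-neighbour
    using () renaming (pick to b; pick-satisfies to b-adjacent; pick-injective to b-injective)

  data Link : V → V → Set where
    link₀ : ∀ n → Link (b n) (e n)
    link₁ : ∀ n → Link (b n) (e (suc n))
    link₂ : ∀ n → Link (b n) (e (suc (suc n)))

  Link⇒E : ∀ {u v} → Link u v → E u v
  Link⇒E (link₀ n) = All.lookup (b-adjacent n) (here refl)
  Link⇒E (link₁ n) = All.lookup (b-adjacent n) (there (here refl))
  Link⇒E (link₂ n) = All.lookup (b-adjacent n) (there (there (here refl)))

  e≢b : ∀ m n → e m ≢ b n
  e≢b m n eq = A-independent G bip (E-sym (Link⇒E (link₀ n))) (e∈A n) (subst A eq (e∈A m))

  OnRay : V → Set
  OnRay v = (∃ λ n → e n ≡ v) ⊎ (∃ λ n → b n ≡ v)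

  RayEdge : V → V → Set
  RayEdge u v = Link u v ⊎ Link v u

  ray : Subgraph G
  ray = record { S = OnRay ; ES = RayEdge ; ES-sub = edge-sub ; ES-sym = edge-sym }
    where
    link-sub : ∀ {u v} → Link u v → E u v × OnRay u × OnRay v
    link-sub (link₀ n) = Link⇒E (link₀ n) , inj₂ (n , refl) , inj₁ (n , refl)
    link-sub (link₁ n) = Link⇒E (link₁ n) , inj₂ (n , refl) , inj₁ (suc n , refl)
    link-sub (link₂ n) = Link⇒E (link₂ n) , inj₂ (n , refl) , inj₁ (suc (suc n) , refl)

    edge-sub : ∀ {u v} → RayEdge u v → E u v × OnRay u × OnRay v
    edge-sub (inj₁ l) = link-sub l
    edge-sub (inj₂ l) with link-sub l
    ... | uv , Su , Sv = E-sym uv , Sv , Su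

    edge-sym : ∀ {u v} → RayEdge u v → RayEdge v u
    edge-sym (inj₁ l) = inj₂ l
    edge-sym (inj₂ l) = inj₁ l

  ray-order : IsPathOrderω G ray (interleave e b)
  ray-order = alternating⇒IsPathOrderω G ray e-injective b-injective e≢b
    (inj₁ ∘ link₀) (inj₂ ∘ link₁) (λ _ onRay → onRay)

  skip₁ : ℕ → ℕ
  skip₁ zero    = zero
  skip₁ (suc n) = suc (suc n)

  skip₁-injective : ∀ m n → skip₁ m ≡ skip₁ n → m ≡ n
  skip₁-injective zero    zero    _    = refl
  skip₁-injective (suc m) (suc n) refl = refl

  skip₁≢1 : ∀ n → skip₁ n ≢ 1
  skip₁≢1 zero    ()
  skip₁≢1 (suc n) ()

  ray-without-e₁-order : (X : V → Set) → (∀ v → X v → v ≡ e 1) → X (e 1) →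
    IsPathOrderω G (delete G ray X) (interleave (e ∘ skip₁) b)
  ray-without-e₁-order X X⊆e₁ Xe₁ =
    alternating⇒IsPathOrderω G (delete G ray X)
      (λ m n eq → skip₁-injective m n (e-injective _ _ eq)) b-injective (e≢b ∘ skip₁)
      b~e e~b cover
    where
    e∉X : ∀ n → ¬ X (e (skip₁ n))
    e∉X n Xe = skip₁≢1 n (e-injective _ _ (X⊆e₁ _ Xe))

    b∉X : ∀ n → ¬ X (b n)
    b∉X n Xb = e≢b 1 n (sym (X⊆e₁ _ Xb))

    b~e : ∀ n → Subgraph.ES (delete G ray X) (b n) (e (skip₁ n))
    b~e zero    = inj₁ (link₀ 0) , b∉X 0 , e∉X 0
    b~e (suc n) = inj₁ (link₁ (suc n)) , b∉X (suc n) , e∉X (suc n)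

    e~b : ∀ n → Subgraph.ES (delete G ray X) (e (skip₁ (suc n))) (b n)
    e~b n = inj₂ (link₂ n) , e∉X (suc n) , b∉X n

    cover : ∀ v → Subgraph.S (delete G ray X) v →
      (∃ λ k → e (skip₁ k) ≡ v) ⊎ (∃ λ k → b k ≡ v)
    cover v (inj₁ (zero , refl)        , _)  = inj₁ (0 , refl)
    cover v (inj₁ (suc zero , refl)    , ∉X) = ⊥-elim (∉X Xe₁)
    cover v (inj₁ (suc (suc n) , refl) , _)  = inj₁ (suc n , refl)
    cover v (inj₂ bk≡v                 , _)  = inj₂ bk≡v

  ray-robust : IsRobustω G ray (_≡ e 1)
  ray-robust X X? X⊆e₁ with X? (e 1)
  ... | yes Xe₁ = _ , ray-without-e₁-order X X⊆e₁ Xe₁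
  ... | no ¬Xe₁ =
    _ , IsPathOrderω-delete-∅ G ray X (λ v Xv → ¬Xe₁ (subst X (X⊆e₁ v Xv) Xv)) ray-order

lemma4p1 : (G : Graph) → (A B : Graph.V G → Set) →
    IsBipartition G A B → CountablyInfinite G A → StarLinkedℵ₀ G A →
    (a : Graph.V G) → A a → (x : Graph.V G) → A x → ¬ (x ≡ a) →
    Σ (Subgraph G) λ R →
      (∃ λ f → IsPathOrderω G R f × f 0 ≡ a) ×
      IsRobustω G R (λ v → v ≡ x) ×
      (∀ v → A v → Subgraph.S R v) ×
      (∃ λ f → IsPathOrderω G (delete G R (λ v → v ≡ x)) f × f 0 ≡ a)
lemma4p1 G A B bip (_ , enumA) starLinked a Aa x Ax x≢a
  with enumeration-starting-with enumA Aa Ax x≢a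
... | e , enum , refl , refl =
  ray ,
  (_ , ray-order , refl) ,
  ray-robust ,
  (λ v Av → inj₁ (proj₂ (proj₂ enum) v Av)) ,
  (_ , ray-without-e₁-order (_≡ e 1) (λ _ v≡e₁ → v≡e₁) refl , refl)
  where open RobustRay G bip starLinked enum
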